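{- Let $s$ be a primitive string over $\Sigma$ and let $M_*(s)$ be the sorted rotation matrix of a context adaptive BWT based on a local ordering. Then for any pair of characters $x_1,x_2\in\Sigma$ there is an order preserving bijection between the set of rows of $M_*(s)$ starting with $x_1x_2$ and the set of rows of $M_*(s)$ starting with $x_2$ and ending with $x_1$.
   Context: A string is primitive if all its cyclic rotations are distinct. A context adaptive BWT: for every string $x$ an ordering (permutation) $\pi_x$ of $\Sigma$ is fixed; the matrix $M_*(s)$ has as rows all cyclic rotations of $s$, sorted so that, for two distinct rotations whose longest common prefix is $x$, the one whose $(|x|+1)$-st symbol is smaller according to $\pi_x$ comes first; $BWT_*(s)$ is the last column of $M_*(s)$. It is based on a local ordering (with $k=1$) if $\pi_x$ depends only on the last symbol of $x$ for every nonempty $x$, i.e. there are $\sigma+1$ orderings: $\pi_\epsilon$ for the empty context and one ordering $\pi_c$ for each $c\in\Sigma$, with $\pi_x=\pi_c$ whenever $x$ ends with $c$. Order preserving means that if row $r$ precedes row $r'$ in $M_*(s)$ then their images appear in the same relative order. -}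

module Defs where

open import Data.Nat using (ℕ)
open import Data.Fin as Fin using (Fin)
open import Data.Fin.Permutation using (Permutation′; _⟨$⟩ʳ_)
open import Data.List using (List; []; _∷_; _++_; length; drop; take; [_])
open import Data.Maybe using (Maybe; just; nothing)
open import Data.Product using (Σ; ∃; _×_)
open import Data.Sum using (_⊎_)
open import Data.Empty using (⊥)
open import Relation.Binary.PropositionalEquality using (_≡_)

Str : ℕ → Set
Str σ = List (Fin σ)

rot : ∀ {σ} (s : Str σ) → Fin (length s) → Str σ
rot s i = drop (Fin.toℕ i) s ++ take (Fin.toℕ i) s

Primitive : ∀ {σ} → Str σ → Set
Primitive s = ∀ i j → rot s i ≡ rot s j → i ≡ j

-- A local ordering (k = 1): an ordering π_ε for the empty context and
-- an ordering π_c for each symbol c.  An ordering of Σ is a permutation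
-- π; symbol a is smaller than b according to π iff π(a) < π(b)
-- (π(a) is the rank of a).
record LocalOrdering (σ : ℕ) : Set where
  field
    πε : Permutation′ σ
    πc : Fin σ → Permutation′ σ

-- Ordering used after context x, given the last symbol of x
-- (nothing if x is empty).
ctxOrd : ∀ {σ} → LocalOrdering σ → Maybe (Fin σ) → Permutation′ σ
ctxOrd L nothing  = LocalOrdering.πε L
ctxOrd L (just c) = LocalOrdering.πc L c

Prec : ∀ {σ} → LocalOrdering σ → Maybe (Fin σ) → Str σ → Str σ → Set
Prec L c (a ∷ u) (b ∷ v) =
  (a ≡ b × Prec L (just a) u v)
  ⊎ (Fin._<_ (ctxOrd L c ⟨$⟩ʳ a) (ctxOrd L c ⟨$⟩ʳ b))
Prec L c _ _ = ⊥

RowPrec : ∀ {σ} → LocalOrdering σ → (s : Str σ) → Fin (length s) → Fin (length s) → Set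
RowPrec L s i j = Prec L nothing (rot s i) (rot s j)

StartsWith2 : ∀ {σ} → Str σ → Fin σ → Fin σ → Set
StartsWith2 r x1 x2 = ∃ λ u → r ≡ x1 ∷ x2 ∷ u

StartsEnds : ∀ {σ} → Str σ → Fin σ → Fin σ → Set
StartsEnds r x2 x1 = ∃ λ u → r ≡ x2 ∷ u ++ [ x1 ]

-- Rows starting with x1 x2 are the rotations x1 x2 u, and rotating each of them
-- once more gives x2 u x1, a row starting with x2 and ending with x1; this is a
-- bijection because rotating by one position is.  It preserves the order
-- because comparing x1 x2 u with x1 x2 v and comparing x2 u x1 with x2 v x1 both
-- come down to comparing u with v after a context ending in x2, which a local
-- ordering treats identically.
module Submission where

open import Defs
open import Data.Nat using (ℕ)
open import Data.Fin using (Fin)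
open import Data.List using (length)
open import Data.Product using (Σ-syntax; ∃-syntax; _×_)
open import Relation.Binary.PropositionalEquality using (_≡_)

open import Data.Nat using (suc; _≟_)
import Data.Nat.Properties as ℕ
open import Data.Fin using (zero; suc; toℕ; fromℕ; inject₁; lower₁)
open import Data.Fin.Properties
  using (toℕ-injective; toℕ-fromℕ; toℕ-lower₁; toℕ-inject₁-≢;
         lower₁-inject₁′; inject₁-lower₁; <-irrefl)
open import Data.List using (List; []; _∷_; _++_; _∷ʳ_; [_]; drop; take; lookup)
open import Data.List.Properties
  using (++-assoc; ++-identityʳ; take-all; drop-all; take-suc; ∷-injective; ∷ʳ-injective)
open import Data.Maybe using (just; nothing)
open import Data.Product using (_,_)
open import Data.Sum using (inj₁; inj₂)
open import Data.Empty using (⊥-elim)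
open import Relation.Nullary using (yes; no; contradiction)
open import Relation.Binary.PropositionalEquality
  using (refl; sym; trans; cong; subst₂; module ≡-Reasoning)

module _ {σ : ℕ} (L : LocalOrdering σ) where

  Prec-++ : ∀ c (u v w w′ : Str σ) → Prec L c u v → Prec L c (u ++ w) (v ++ w′)
  Prec-++ c (a ∷ u) (.a ∷ v) w w′ (inj₁ (refl , u≺v)) = inj₁ (refl , Prec-++ (just a) u v w w′ u≺v)
  Prec-++ c (a ∷ u) (b ∷ v)  w w′ (inj₂ a<b)          = inj₂ a<b

  Prec-∷⁻ : ∀ c a (u v : Str σ) → Prec L c (a ∷ u) (a ∷ v) → Prec L (just a) u v
  Prec-∷⁻ c a u v (inj₁ (_ , u≺v)) = u≺v
  Prec-∷⁻ c a u v (inj₂ a<a)       = ⊥-elim (<-irrefl refl a<a)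

  Prec-∷⁺ : ∀ c a (u v : Str σ) → Prec L (just a) u v → Prec L c (a ∷ u) (a ∷ v)
  Prec-∷⁺ c a u v u≺v = inj₁ (refl , u≺v)

  Prec-rotate : ∀ c x1 x2 (u v : Str σ) →
    Prec L c (x1 ∷ x2 ∷ u) (x1 ∷ x2 ∷ v) → Prec L c (x2 ∷ u ∷ʳ x1) (x2 ∷ v ∷ʳ x1)
  Prec-rotate c x1 x2 u v x1x2u≺x1x2v =
    Prec-∷⁺ c x2 (u ∷ʳ x1) (v ∷ʳ x1)
      (Prec-++ (just x2) u v [ x1 ] [ x1 ]
        (Prec-∷⁻ (just x1) x2 u v (Prec-∷⁻ c x1 (x2 ∷ u) (x2 ∷ v) x1x2u≺x1x2v)))

cyclicSuc : ∀ {n} → Fin n → Fin n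
cyclicSuc {suc m} i with m ≟ toℕ i
... | yes _   = zero
... | no m≢i  = suc (lower₁ i m≢i)

cyclicPred : ∀ {n} → Fin n → Fin n
cyclicPred {suc m} zero    = fromℕ m
cyclicPred {suc m} (suc j) = inject₁ j

cyclicSuc-cyclicPred : ∀ {n} (j : Fin n) → cyclicSuc (cyclicPred j) ≡ j
cyclicSuc-cyclicPred {suc m} zero with m ≟ toℕ (fromℕ m)
... | yes _  = refl
... | no m≢m = contradiction (sym (toℕ-fromℕ m)) m≢m
cyclicSuc-cyclicPred {suc m} (suc j) with m ≟ toℕ (inject₁ j)
... | yes m≡j = contradiction m≡j (toℕ-inject₁-≢ j)
... | no m≢j  = cong suc (lower₁-inject₁′ j m≢j)

cyclicPred-cyclicSuc : ∀ {n} (i : Fin n) → cyclicPred (cyclicSuc i) ≡ i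
cyclicPred-cyclicSuc {suc m} i with m ≟ toℕ i
... | yes m≡i = toℕ-injective (trans (toℕ-fromℕ m) m≡i)
... | no m≢i  = inject₁-lower₁ i m≢i

cyclicSuc-injective : ∀ {n} (i j : Fin n) → cyclicSuc i ≡ cyclicSuc j → i ≡ j
cyclicSuc-injective i j eq = begin
  i                        ≡⟨ sym (cyclicPred-cyclicSuc i) ⟩
  cyclicPred (cyclicSuc i) ≡⟨ cong cyclicPred eq ⟩
  cyclicPred (cyclicSuc j) ≡⟨ cyclicPred-cyclicSuc j ⟩
  j                        ∎
  where open ≡-Reasoning

drop-lookup : ∀ {a} {A : Set a} (xs : List A) (i : Fin (length xs)) →
  drop (toℕ i) xs ≡ lookup xs i ∷ drop (suc (toℕ i)) xs
drop-lookup (x ∷ xs) zero    = refl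
drop-lookup (x ∷ xs) (suc i) = drop-lookup xs i

module _ {σ : ℕ} where

  rot-uncons : (s : Str σ) (i : Fin (length s)) →
    rot s i ≡ lookup s i ∷ drop (suc (toℕ i)) s ++ take (toℕ i) s
  rot-uncons s i = cong (_++ take (toℕ i) s) (drop-lookup s i)

  rot-cyclicSuc : (s : Str σ) (i : Fin (length s)) →
    rot s (cyclicSuc i) ≡ drop (suc (toℕ i)) s ++ take (suc (toℕ i)) s
  rot-cyclicSuc s@(x ∷ xs) i with length xs ≟ toℕ i
  ... | yes n≡i rewrite sym n≡i = begin
    s ++ []                                ≡⟨ ++-identityʳ s ⟩
    s                                      ≡⟨ sym (take-all n s ℕ.≤-refl) ⟩
    take n s                               ≡⟨ cong (_++ take n s) (sym (drop-all n s ℕ.≤-refl)) ⟩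
    drop n s ++ take n s                   ∎
    where
    n = length s
    open ≡-Reasoning
  ... | no n≢i = cong (λ k → drop k s ++ take k s) (cong suc (toℕ-lower₁ i n≢i))

  rot-cyclicSuc-∷ʳ : (s : Str σ) (i : Fin (length s)) {a : Fin σ} {r : Str σ} →
    rot s i ≡ a ∷ r → rot s (cyclicSuc i) ≡ r ∷ʳ a
  rot-cyclicSuc-∷ʳ s i eq with ∷-injective (trans (sym eq) (rot-uncons s i))
  ... | refl , refl = begin
    rot s (cyclicSuc i)                        ≡⟨ rot-cyclicSuc s i ⟩
    drop (suc k) s ++ take (suc k) s           ≡⟨ cong (drop (suc k) s ++_) (take-suc s i) ⟩
    drop (suc k) s ++ (take k s ∷ʳ lookup s i) ≡⟨ sym (++-assoc (drop (suc k) s) (take k s) _) ⟩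
    (drop (suc k) s ++ take k s) ∷ʳ lookup s i ∎
    where
    k = toℕ i
    open ≡-Reasoning

  rot-cyclicPred-∷ : (s : Str σ) (j : Fin (length s)) {a : Fin σ} {r : Str σ} →
    rot s j ≡ r ∷ʳ a → rot s (cyclicPred j) ≡ a ∷ r
  rot-cyclicPred-∷ s j {a} {r} eq with ∷ʳ-injective _ r rotations-agree
    where
    i = cyclicPred j
    rotations-agree : (drop (suc (toℕ i)) s ++ take (toℕ i) s) ∷ʳ lookup s i ≡ r ∷ʳ a
    rotations-agree = begin
      _                   ≡⟨ sym (rot-cyclicSuc-∷ʳ s i (rot-uncons s i)) ⟩
      rot s (cyclicSuc i) ≡⟨ cong (rot s) (cyclicSuc-cyclicPred j) ⟩
      rot s j             ≡⟨ eq ⟩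
      r ∷ʳ a              ∎
      where open ≡-Reasoning
  ... | refl , refl = rot-uncons s (cyclicPred j)

lemma9 : ∀ {σ : ℕ} (L : LocalOrdering σ) (s : Str σ) → Primitive s →
    (x1 x2 : Fin σ) →
    Σ[ f ∈ (Fin (length s) → Fin (length s)) ]
      ((∀ i → StartsWith2 (rot s i) x1 x2 → StartsEnds (rot s (f i)) x2 x1)
      × (∀ i j → StartsWith2 (rot s i) x1 x2 → StartsWith2 (rot s j) x1 x2 →
           f i ≡ f j → i ≡ j)
      × (∀ j → StartsEnds (rot s j) x2 x1 →
           ∃[ i ] (StartsWith2 (rot s i) x1 x2 × f i ≡ j))
      × (∀ i j → StartsWith2 (rot s i) x1 x2 → StartsWith2 (rot s j) x1 x2 →
           RowPrec L s i j → RowPrec L s (f i) (f j)))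
lemma9 L s _ x1 x2 =
  cyclicSuc ,
  (λ i (u , eu) → u , rot-cyclicSuc-∷ʳ s i eu) ,
  (λ i j _ _ → cyclicSuc-injective i j) ,
  (λ j (u , eu) → cyclicPred j , (u , rot-cyclicPred-∷ s j eu) , cyclicSuc-cyclicPred j) ,
  λ i j (u , eu) (v , ev) i≺j →
    subst₂ (Prec L nothing) (sym (rot-cyclicSuc-∷ʳ s i eu)) (sym (rot-cyclicSuc-∷ʳ s j ev))
      (Prec-rotate L nothing x1 x2 u v (subst₂ (Prec L nothing) eu ev i≺j))
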